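{- Let $X$ be a set and $R:X\to X\to\mathsf{Prop}$ an equivalence relation. Then weak bisimilarity up to $R$, $\approx_R$ on $DX$, is an equivalence relation.
   Context: We work in Clocked Cubical Type Theory; "set"/"proposition" mean clock-irrelevant homotopy sets/propositions. For a clock $\kappa$, $D^\kappa X\simeq X+\triangleright^\kappa(D^\kappa X)$ is the guarded delay monad with $\mathsf{now}^\kappa$, $\mathsf{step}^\kappa:\triangleright^\kappa(D^\kappa X)\to D^\kappa X$, and $\triangleright^\kappa$ the later modality (tick abstraction $\lambda(\alpha{:}\kappa).t$, tick application $t[\alpha]$); write $\delta^\kappa=\mathsf{step}^\kappa\circ\mathsf{next}^\kappa$ where $\mathsf{next}^\kappa(x)=\lambda(\alpha{:}\kappa).x$. The coinductive delay monad is $DX=\forall\kappa.D^\kappa X$ with $\mathsf{now},\mathsf{step}$. For $R:X\to Y\to\mathsf{Prop}$, the guarded weak bisimilarity $\approx^\kappa_R:D^\kappa X\to D^\kappa Y\to\mathsf{Prop}$ is defined by guarded recursion: $\mathsf{now}^\kappa(x)\approx^\kappa_R y$ iff $\exists n:\mathbb{N},y':Y.\ y=(\delta^\kappa)^n(\mathsf{now}^\kappa y')$ and $R(x,y')$; $x\approx^\kappa_R\mathsf{now}^\kappa(y)$ iff $\exists n,x'.\ x=(\delta^\kappa)^n(\mathsf{now}^\kappa x')$ and $R(x',y)$; $\mathsf{step}^\kappa(x)\approx^\kappa_R\mathsf{step}^\kappa(y)$ iff $\triangleright(\alpha{:}\kappa).(x[\alpha]\approx^\kappa_R y[\alpha])$.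 Weak bisimilarity up to $R$ on the coinductive delay monad is $x\approx_R y$ iff $\forall\kappa.\ x[\kappa]\approx^\kappa_R y[\kappa]$; equivalently, coinductively: $\mathsf{now}(x)\approx_R y$ iff $y=\mathsf{step}^n(\mathsf{now}\,y')$ for some $n$, $y'$ with $R(x,y')$; symmetrically; and $\mathsf{step}(x)\approx_R\mathsf{step}(y)$ iff $x\approx_R y$. -}

module Defs where

open import Level using (Level; _⊔_) renaming (suc to lsuc)
open import Data.Nat using (ℕ; zero; suc)
open import Data.Maybe using (Maybe; just; nothing)
open import Data.Product using (Σ; _×_)
open import Relation.Binary.PropositionalEquality using (_≡_)

record Delay {a} (A : Set a) : Set a where
  constructor delay
  field seq : ℕ → Maybe A

open Delay public

-- one unfolding:  D X ≃ X + D X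
data Delay′ {a} (A : Set a) : Set a where
  now  : A → Delay′ A
  step : Delay A → Delay′ A

force : ∀ {a} {A : Set a} → Delay A → Delay′ A
force d with seq d zero
... | just x  = now x
... | nothing = step (delay (λ n → seq d (suc n)))

data _⇓′_ {a} {A : Set a} : Delay′ A → A → Set a where
  now⇓  : ∀ {x} → now x ⇓′ x
  step⇓ : ∀ {d x} → force d ⇓′ x → step d ⇓′ x

-- Weak bisimilarity up to R, defined coinductively (greatest fixed point
-- of the following one-step functor, exactly the paper's clauses):
--   now x ≈_R y       iff  y = step^n (now y') with R x y'
--   x ≈_R now y       iff  x = step^n (now x') with R x' y
--   step x ≈_R step y iff  x ≈_R y

data WBStep {a r q} {X : Set a} (R : X → X → Set r)
            (Q : Delay X → Delay X → Set q)
            : Delay′ X → Delay′ X → Set (a ⊔ r ⊔ q) where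
  now≈  : ∀ {x v y′} → v ⇓′ y′ → R x y′ → WBStep R Q (now x) v
  ≈now  : ∀ {u x′ y} → u ⇓′ x′ → R x′ y → WBStep R Q u (now y)
  step≈ : ∀ {x y} → Q x y → WBStep R Q (step x) (step y)

IsWBisim : ∀ {a r q} {X : Set a} (R : X → X → Set r)
           → (Delay X → Delay X → Set q) → Set (a ⊔ r ⊔ q)
IsWBisim R Q = ∀ u v → Q u v → WBStep R Q (force u) (force v)

_≈⟨_⟩_ : ∀ {a r} {X : Set a} → Delay X → (X → X → Set r) → Delay X
         → Set (lsuc (a ⊔ r))
_≈⟨_⟩_ {a} {r} {X} x R y =
  Σ (Delay X → Delay X → Set (a ⊔ r)) λ Q → IsWBisim R Q × Q x y

IsSet : ∀ {a} → Set a → Set a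
IsSet X = ∀ {x y : X} (p q : x ≡ y) → p ≡ q

IsPropValued : ∀ {a r} {X : Set a} → (X → X → Set r) → Set (a ⊔ r)
IsPropValued {X = X} R = ∀ {x y : X} (p q : R x y) → p ≡ q

-- Reflexivity, symmetry and transitivity of ≈⟨ R ⟩ are witnessed by explicit weak
-- bisimulations: the identity, the converse of a bisimulation, and the composite
-- of two bisimulations enlarged by the pairs that both converge to R-related
-- values. The enlargement is needed because a composite step may pass through a
-- value on the middle computation while both outer ones are still stepping; what
-- makes it work is that a bisimulation step carries convergence of one side over
-- to the other, since the value of a converging computation is unique.
{-# OPTIONS --safe #-}
module Submission where

open import Defs
open import Level using (Level; _⊔_; Lift; lift)
open import Function using (flip)
open import Data.Product using (∃; ∃₂; _×_; _,_)
open import Data.Sum using (_⊎_; inj₁; inj₂)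
open import Relation.Binary.Core using (Rel; _⇒_)
open import Relation.Binary.Definitions using (Reflexive; Symmetric; Transitive)
open import Relation.Binary.Structures using (IsEquivalence)
open import Relation.Binary.PropositionalEquality using (_≡_; refl)

module _ {a : Level} {X : Set a} where

  private
    variable
      r r′ q q₁ q₂ : Level
      R R′ : Rel X r
      Q : Rel (Delay X) q
      u v w : Delay′ X
      x y : X

  ⇓′-deterministic : u ⇓′ x → u ⇓′ y → x ≡ y
  ⇓′-deterministic now⇓      now⇓       = refl
  ⇓′-deterministic (step⇓ p) (step⇓ p′) = ⇓′-deterministic p p′

  BothConverge : Rel X r → Rel (Delay X) (a ⊔ r)
  BothConverge R d e = ∃₂ λ x y → force d ⇓′ x × force e ⇓′ y × R x y

  Composite : Rel X r → Rel (Delay X) q₁ → Rel (Delay X) q₂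
            → Rel (Delay X) (a ⊔ r ⊔ q₁ ⊔ q₂)
  Composite R Q₁ Q₂ d f = (∃ λ e → Q₁ d e × Q₂ e f) ⊎ BothConverge R d f

  WBStep-mono : R ⇒ R′ → WBStep R Q ⇒ WBStep R′ Q
  WBStep-mono R⇒R′ (now≈ p r) = now≈ p (R⇒R′ r)
  WBStep-mono R⇒R′ (≈now p r) = ≈now p (R⇒R′ r)
  WBStep-mono R⇒R′ (step≈ q)  = step≈ q

  WBStep-flip : WBStep R Q u v → WBStep (flip R) (flip Q) v u
  WBStep-flip (now≈ p r) = ≈now p r
  WBStep-flip (≈now p r) = now≈ p r
  WBStep-flip (step≈ q)  = step≈ q

  WBStep-refl : Reflexive R → Reflexive Q → Reflexive (WBStep R Q)
  WBStep-refl R-refl Q-refl {now x}  = now≈ now⇓ R-refl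
  WBStep-refl R-refl Q-refl {step d} = step≈ Q-refl

  ⇓′-WBStep : BothConverge R ⇒ Q → u ⇓′ x → v ⇓′ y → R x y → WBStep R Q u v
  ⇓′-WBStep conv⇒Q now⇓       p′        r = now≈ p′ r
  ⇓′-WBStep conv⇒Q (step⇓ p) now⇓       r = ≈now (step⇓ p) r
  ⇓′-WBStep conv⇒Q (step⇓ p) (step⇓ p′) r = step≈ (conv⇒Q (_ , _ , p , p′ , r))

  IsWBisim-mono : R ⇒ R′ → IsWBisim R Q → IsWBisim R′ Q
  IsWBisim-mono R⇒R′ isQ d e q = WBStep-mono R⇒R′ (isQ d e q)

  IsWBisim-flip : IsWBisim R Q → IsWBisim (flip R) (flip Q)
  IsWBisim-flip isQ d e q = WBStep-flip (isQ e d q)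

  WBStep-⇓′ˡ : IsWBisim R Q → WBStep R Q u v → u ⇓′ x → ∃ λ y → v ⇓′ y × R x y
  WBStep-⇓′ˡ isQ (now≈ p r) now⇓ = _ , p , r
  WBStep-⇓′ˡ isQ (≈now p r) p′
    with refl ← ⇓′-deterministic p p′ = _ , now⇓ , r
  WBStep-⇓′ˡ isQ (step≈ {d} {e} q) (step⇓ p)
    with y , p′ , r ← WBStep-⇓′ˡ isQ (isQ d e q) p = y , step⇓ p′ , r

  WBStep-⇓′ʳ : IsWBisim R Q → WBStep R Q u v → v ⇓′ y → ∃ λ x → u ⇓′ x × R x y
  WBStep-⇓′ʳ isQ s = WBStep-⇓′ˡ (IsWBisim-flip isQ) (WBStep-flip s)

  IsWBisim-composite : {Q₁ : Rel (Delay X) q₁} {Q₂ : Rel (Delay X) q₂}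
                     → Transitive R → IsWBisim R Q₁ → IsWBisim R Q₂
                     → IsWBisim R (Composite R Q₁ Q₂)
  IsWBisim-composite {R = R} {Q₁ = Q₁} {Q₂} R-trans isQ₁ isQ₂ = isQ
    where
    converge : u ⇓′ x → v ⇓′ y → R x y → WBStep R (Composite R Q₁ Q₂) u v
    converge = ⇓′-WBStep inj₂

    compose : WBStep R Q₁ u v → WBStep R Q₂ v w → WBStep R (Composite R Q₁ Q₂) u w
    compose (step≈ q₁) (step≈ q₂) = step≈ (inj₁ (_ , q₁ , q₂))
    compose (now≈ p r) s₂
      with _ , p′ , r′ ← WBStep-⇓′ˡ isQ₂ s₂ p = converge now⇓ p′ (R-trans r r′)
    compose (≈now p r) s₂
      with _ , p′ , r′ ← WBStep-⇓′ˡ isQ₂ s₂ now⇓ = converge p p′ (R-trans r r′)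
    compose s₁@(step≈ _) (≈now p r)
      with _ , p′ , r′ ← WBStep-⇓′ʳ isQ₁ s₁ p = converge p′ now⇓ (R-trans r′ r)

    isQ : IsWBisim R (Composite R Q₁ Q₂)
    isQ d f (inj₁ (e , q₁ , q₂))        = compose (isQ₁ d e q₁) (isQ₂ e f q₂)
    isQ d f (inj₂ (_ , _ , p , p′ , r)) = converge p p′ r

module _ {a r : Level} {X : Set a} {R : Rel X r} where

  ≈-refl : Reflexive R → Reflexive (_≈⟨ R ⟩_)
  ≈-refl R-refl = Identity , isIdentity , lift refl
    where
    Identity : Rel (Delay X) (a ⊔ r)
    Identity d e = Lift (a ⊔ r) (d ≡ e)

    isIdentity : IsWBisim R Identity
    isIdentity d .d (lift refl) = WBStep-refl R-refl (lift refl)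

  ≈-sym : Symmetric R → Symmetric (_≈⟨ R ⟩_)
  ≈-sym R-sym (Q , isQ , q) = flip Q , IsWBisim-mono R-sym (IsWBisim-flip isQ) , q

  ≈-trans : Transitive R → Transitive (_≈⟨ R ⟩_)
  ≈-trans R-trans (Q₁ , isQ₁ , q₁) (Q₂ , isQ₂ , q₂) =
    Composite R Q₁ Q₂ , IsWBisim-composite R-trans isQ₁ isQ₂ , inj₁ (_ , q₁ , q₂)

lemma7p4 : ∀ {a r} {X : Set a} (R : X → X → Set r)
    → IsSet X → IsPropValued R → IsEquivalence R
    → IsEquivalence (λ (x y : Delay X) → x ≈⟨ R ⟩ y)
lemma7p4 R _ _ R-equiv = record
  { refl  = ≈-refl R.refl
  ; sym   = ≈-sym R.sym
  ; trans = ≈-trans R.trans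
  }
  where module R = IsEquivalence R-equiv
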